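{- If a fullerene graph $F$ contains a pentagonal ring $R$ of length five, then $R$ is isomorphic to $R_5$, i.e., $R$ consists of the five pentagons surrounding a pentagonal face of $F$.
   Context: A fullerene graph is a 3-connected plane cubic graph with exactly 12 pentagonal faces and all other faces hexagonal. For $l\ge 3$, let $f_i$ ($i\in\mathbb Z_l$) be a cyclic sequence of $l$ faces of $F$ such that consecutive faces $f_i,f_{i+1}$ intersect only in an edge $e_i$, and non-consecutive faces are disjoint; if $\{e_i\}$ is a matching, then $R=\bigcup_i f_i$ is a polygonal ring of length $l$; it is a pentagonal ring if all $f_i$ are pentagons. $R_5$ is the graph obtained from the dodecahedron by deleting the vertices of one pentagonal face (a central pentagon together with the five pentagons adjacent to it; the five outer pentagons form a pentagonal ring of length five). -}

module Defs where

open import Data.Nat using (ℕ; zero; suc; _+_; _*_; _≤_; _<_; _≤ᵇ_; _≡ᵇ_)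
open import Data.Nat.Properties using (_<?_)
open import Data.Fin using (Fin; zero; suc; toℕ; fromℕ<)
open import Data.Product using (Σ; ∃; _×_; _,_; proj₁; proj₂)
open import Data.Sum using (_⊎_)
open import Data.Bool using (Bool; true; false; _∧_; not)
open import Data.List.Base using (List; []; _∷_; map; concatMap; length; filterᵇ; upTo; drop)
open import Data.Bool.ListAction using (all)
open import Data.List using () renaming (allFin to allFinL)
open import Relation.Nullary using (¬_; yes; no)
open import Relation.Binary.PropositionalEquality using (_≡_; _≢_)

-- Plane cubic graphs as combinatorial maps (rotation systems).
--
-- Each vertex carries three half-edges (darts)
-- (v , 0), (v , 1), (v , 2), listed in the cyclic (say clockwise) order
-- in which the incident edges leave v in the embedding.  An edge is a
-- pair {d , α d} of darts exchanged by the fixed-point-free involution α.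
-- The vertex rotation is σ (v , i) = (v , i+1 mod 3) and the face
-- permutation is φ = σ ∘ α; the faces of the embedding are the φ-orbits.

Dart : ℕ → Set
Dart n = Fin n × Fin 3

rot3 : Fin 3 → Fin 3
rot3 zero = suc zero
rot3 (suc zero) = suc (suc zero)
rot3 (suc (suc zero)) = zero

σ : ∀ {n} → Dart n → Dart n
σ (v , i) = v , rot3 i

vert : ∀ {n} → Dart n → Fin n
vert = proj₁

iter : ∀ {A : Set} → (A → A) → ℕ → A → A
iter f zero x = x
iter f (suc k) x = f (iter f k x)

record CubicMap (n : ℕ) : Set where
  field
    α       : Dart n → Dart n
    α-invol : ∀ d → α (α d) ≡ d
open CubicMap public

module _ {n : ℕ} (M : CubicMap n) where

  φ : Dart n → Dart n
  φ d = σ (α M d)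

  Adj : Fin n → Fin n → Set
  Adj u w = Σ (Fin 3) λ i → vert (α M (u , i)) ≡ w

  data WalkIn (P : Fin n → Set) : Fin n → Fin n → Set where
    here : ∀ {u} → WalkIn P u u
    step : ∀ {u v w} → Adj u v → P v → WalkIn P v w → WalkIn P u w

  record Simple : Set where
    field
      noLoop  : ∀ d → vert (α M d) ≢ vert d
      noMulti : ∀ v i j → i ≢ j → vert (α M (v , i)) ≢ vert (α M (v , j))

  ThreeConnected : Set
  ThreeConnected =
    (4 ≤ n) ×
    (∀ x y u w → u ≢ x → u ≢ y → w ≢ x → w ≢ y →
       WalkIn (λ v → (v ≢ x) × (v ≢ y)) u w)

  FaceSize : Dart n → ℕ → Set
  FaceSize d k = (0 < k) × (iter φ k d ≡ d) ×
                 (∀ j → 0 < j → j < k → iter φ j d ≢ d)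

  SameFace : Dart n → Dart n → Set
  SameFace d e = ∃ λ k → iter φ k d ≡ e

  EdgeOnFace : Dart n → Dart n → Set
  EdgeOnFace e d = SameFace d e ⊎ SameFace d (α M e)

  SameEdge : Dart n → Dart n → Set
  SameEdge e e' = (e' ≡ e) ⊎ (e' ≡ α M e)

  VertexOnFace : Fin n → Dart n → Set
  VertexOnFace v d = ∃ λ k → vert (iter φ k d) ≡ v

  Endpoint : Fin n → Dart n → Set
  Endpoint v e = (v ≡ vert e) ⊎ (v ≡ vert (α M e))

  -- Counting faces (φ-orbits): a face is counted by its dart of least
  -- rank; every orbit has at most 3n darts.
  allDarts : List (Dart n)
  allDarts = concatMap (λ v → map (λ i → v , i) (allFinL 3)) (allFinL n)

  rank : Dart n → ℕ
  rank (v , i) = 3 * toℕ v + toℕ i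

  _==ᵈ_ : Dart n → Dart n → Bool
  (v , i) ==ᵈ (w , j) = (toℕ v ≡ᵇ toℕ w) ∧ (toℕ i ≡ᵇ toℕ j)

  isFaceRep : Dart n → Bool
  isFaceRep d = all (λ k → rank d ≤ᵇ rank (iter φ k d)) (upTo (3 * n))

  hasFaceSizeᵇ : ℕ → Dart n → Bool
  hasFaceSizeᵇ k d = not (k ≡ᵇ 0) ∧ (iter φ k d ==ᵈ d)
                     ∧ all (λ j → not (iter φ j d ==ᵈ d)) (drop 1 (upTo k))

  numFaces : ℕ
  numFaces = length (filterᵇ isFaceRep allDarts)

  numPentagons : ℕ
  numPentagons = length (filterᵇ (λ d → isFaceRep d ∧ hasFaceSizeᵇ 5 d) allDarts)

  -- plane (spherical) embedding: Euler's formula V − E + F = 2 for the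
  -- connected map, with V = n, E = 3n/2, i.e. 2F = n + 4.
  Plane : Set
  Plane = 2 * numFaces ≡ n + 4

  record IsFullerene : Set where
    field
      simple     : Simple
      threeConn  : ThreeConnected
      plane      : Plane
      faces56    : ∀ d → FaceSize d 5 ⊎ FaceSize d 6
      twelvePent : numPentagons ≡ 12

nextFin : ∀ {l} → Fin l → Fin l
nextFin {suc l} i with suc (toℕ i) <? suc l
... | yes p = fromℕ< p
... | no _  = zero

-- Polygonal and pentagonal rings.  A ring of length l is given by
-- faces f i (represented by a dart of each face) and the edges e i
-- (represented by a dart) with  f i ∩ f (i+1) = e i.
module _ {n : ℕ} (M : CubicMap n) where

  record PolygonalRing (l : ℕ) : Set where
    field
      three≤l : 3 ≤ l
      f : Fin l → Dart n
      e : Fin l → Dart n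
      e-on-f   : ∀ i → EdgeOnFace M (e i) (f i)
      e-on-f⁺  : ∀ i → EdgeOnFace M (e i) (f (nextFin i))
      onlyEdge : ∀ i e' → EdgeOnFace M e' (f i) → EdgeOnFace M e' (f (nextFin i))
                   → SameEdge M (e i) e'
      onlyEnds : ∀ i v → VertexOnFace M v (f i) → VertexOnFace M v (f (nextFin i))
                   → Endpoint M v (e i)
      disjoint : ∀ i j → j ≢ i → j ≢ nextFin i → i ≢ nextFin j →
                   ∀ v → VertexOnFace M v (f i) → ¬ VertexOnFace M v (f j)
      matching : ∀ i j → i ≢ j → ∀ v → Endpoint M v (e i) → ¬ Endpoint M v (e j)

  record PentagonalRing (l : ℕ) : Set where
    field
      ring : PolygonalRing l
      pent : ∀ i → FaceSize M (PolygonalRing.f ring i) 5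

-- The five shared edges e₀,…,e₄ of the ring form a matching, so on the pentagon f (i+1) the
-- edges eᵢ and eᵢ₊₁ are separated by one edge on one side and two on the other.  Orient each
-- eᵢ as the dart aᵢ lying on fᵢ; then walking 2 or 3 steps along f (i+1) from α aᵢ reaches aᵢ₊₁.
-- If every hop has length 2, the third faces at the tails of the aᵢ close up after five steps
-- into a pentagon adjacent to all fᵢ; if every hop has length 3, the same happens on the other
-- side (reversing the ring turns hops of length 3 into hops of length 2).  A mixture of
-- lengths is impossible: up to rotation and reversal it is one of the patterns 32222, 33222,
-- 32322, and in each, chasing the face through the third dart at a₀ produces either a face
-- with fewer than five sides or a loop.
module Submission where

open import Defs hiding (α; α-invol; φ)
import Defs
open import Data.Nat using (ℕ; zero; suc; _+_; _*_; _∸_; _<_; z<s)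
open import Data.Nat.Properties using (+-comm; m∸n+n≡m; <⇒≤; m<n⇒m<1+n; n<1+n)
open import Data.Nat.DivMod using (_%_; _/_; m≡m%n+[m/n]*n; m%n<n)
open import Data.Fin using (Fin; toℕ; fromℕ<)
open import Data.Fin.Properties using (toℕ-fromℕ<; toℕ<n)
open import Data.Fin.Patterns using (0F; 1F; 2F; 3F; 4F)
open import Data.Product using (Σ; _×_; _,_; proj₁; proj₂)
open import Data.Sum using (_⊎_; inj₁; inj₂; [_,_]′)
import Data.Sum as Sum
open import Data.Empty using (⊥; ⊥-elim)
open import Function using (_∘_)
open import Relation.Nullary using (¬_)
open import Relation.Binary.PropositionalEquality
  using (_≡_; _≢_; refl; sym; trans; cong; subst; module ≡-Reasoning)
open ≡-Reasoning

iter-+ : ∀ {A : Set} (f : A → A) j k x → iter f (j + k) x ≡ iter f j (iter f k x)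
iter-+ f zero    k x = refl
iter-+ f (suc j) k x = cong f (iter-+ f j k x)

iter-comm : ∀ {A : Set} (f : A → A) j k x → iter f j (iter f k x) ≡ iter f k (iter f j x)
iter-comm f j k x = begin
  iter f j (iter f k x) ≡⟨ sym (iter-+ f j k x) ⟩
  iter f (j + k) x      ≡⟨ cong (λ m → iter f m x) (+-comm j k) ⟩
  iter f (k + j) x      ≡⟨ iter-+ f k j x ⟩
  iter f k (iter f j x) ∎

σ³ : ∀ {n} (d : Dart n) → σ (σ (σ d)) ≡ d
σ³ (v , 0F) = refl
σ³ (v , 1F) = refl
σ³ (v , 2F) = refl

σ-injective : ∀ {n} {x y : Dart n} → σ x ≡ σ y → x ≡ y
σ-injective {x = x} {y} p = begin
  x             ≡⟨ sym (σ³ x) ⟩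
  σ (σ (σ x))   ≡⟨ cong (σ ∘ σ) p ⟩
  σ (σ (σ y))   ≡⟨ σ³ y ⟩
  y             ∎

σ-no-fixpoint : ∀ {n} (d : Dart n) → σ d ≢ d
σ-no-fixpoint (v , 0F) ()
σ-no-fixpoint (v , 1F) ()
σ-no-fixpoint (v , 2F) ()

σ²-no-fixpoint : ∀ {n} (d : Dart n) → σ (σ d) ≢ d
σ²-no-fixpoint (v , 0F) ()
σ²-no-fixpoint (v , 1F) ()
σ²-no-fixpoint (v , 2F) ()

module _ {n : ℕ} (M : CubicMap n) where
  open CubicMap M

  φ : Dart n → Dart n
  φ = Defs.φ M

  α-injective : ∀ {x y} → α x ≡ α y → x ≡ y
  α-injective {x} {y} p = begin
    x         ≡⟨ sym (α-invol x) ⟩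
    α (α x)   ≡⟨ cong α p ⟩
    α (α y)   ≡⟨ α-invol y ⟩
    y         ∎

  φ-injective : ∀ {x y} → φ x ≡ φ y → x ≡ y
  φ-injective = α-injective ∘ σ-injective

  φ-α : ∀ d → φ (α d) ≡ σ d
  φ-α d = cong σ (α-invol d)

  φ-α-σ² : ∀ d → φ (α (σ (σ d))) ≡ d
  φ-α-σ² d = trans (φ-α (σ (σ d))) (σ³ d)

  φ²≢σ : ∀ d → φ (φ d) ≢ σ d
  φ²≢σ d p = σ-no-fixpoint (α d) (trans (sym (α-invol (φ d))) (cong α (σ-injective p)))

  SameFace-trans : ∀ {x y z} → SameFace M x y → SameFace M y z → SameFace M x z
  SameFace-trans {x} (j , p) (k , q) = k + j , trans (iter-+ φ k j x) (trans (cong (iter φ k) p) q)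

  SameFace-φ : ∀ {x y} → SameFace M x y → SameFace M x (φ y)
  SameFace-φ (k , p) = suc k , cong φ p

  SameFace-across : ∀ {x y} → SameFace M x (α y) → SameFace M x (σ y)
  SameFace-across {y = y} (k , p) = suc k , trans (cong φ p) (φ-α y)

  Pentagon : Dart n → Set
  Pentagon d = iter φ 5 d ≡ d

  Pentagon-iter-* : ∀ {x} → Pentagon x → ∀ q → iter φ (q * 5) x ≡ x
  Pentagon-iter-* p zero    = refl
  Pentagon-iter-* {x} p (suc q) = begin
    iter φ (5 + q * 5) x        ≡⟨ iter-+ φ 5 (q * 5) x ⟩
    iter φ 5 (iter φ (q * 5) x) ≡⟨ cong (iter φ 5) (Pentagon-iter-* p q) ⟩
    iter φ 5 x                  ≡⟨ p ⟩
    x                           ∎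

  Pentagon-SameFace : ∀ {x y} → Pentagon x → SameFace M x y → Pentagon y
  Pentagon-SameFace {x} p (k , refl) = trans (iter-comm φ 5 k x) (cong (iter φ k) p)

  pentagon-position : ∀ {x y} → Pentagon x → SameFace M x y →
                      Σ (Fin 5) λ m → iter φ (toℕ m) x ≡ y
  pentagon-position {x} p (k , q) = fromℕ< (m%n<n k 5) , (begin
    iter φ (toℕ (fromℕ< (m%n<n k 5))) x       ≡⟨ cong (λ m → iter φ m x) (toℕ-fromℕ< (m%n<n k 5)) ⟩
    iter φ (k % 5) x                          ≡⟨ cong (iter φ (k % 5)) (sym (Pentagon-iter-* p (k / 5))) ⟩
    iter φ (k % 5) (iter φ (k / 5 * 5) x)     ≡⟨ sym (iter-+ φ (k % 5) (k / 5 * 5) x) ⟩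
    iter φ (k % 5 + k / 5 * 5) x              ≡⟨ cong (λ m → iter φ m x) (sym (m≡m%n+[m/n]*n k 5)) ⟩
    iter φ k x                                ≡⟨ q ⟩
    _                                         ∎)

  SameFace-sym : ∀ {x y} → Pentagon x → SameFace M x y → SameFace M y x
  SameFace-sym {x} p s with pentagon-position p s
  ... | m , refl = 5 ∸ toℕ m , (begin
    iter φ (5 ∸ toℕ m) (iter φ (toℕ m) x) ≡⟨ sym (iter-+ φ (5 ∸ toℕ m) (toℕ m) x) ⟩
    iter φ (5 ∸ toℕ m + toℕ m) x          ≡⟨ cong (λ k → iter φ k x) (m∸n+n≡m (<⇒≤ (toℕ<n m))) ⟩
    iter φ 5 x                            ≡⟨ p ⟩
    x                                     ∎)

  -- A dart of the face at the vertex of d other than the faces of d and of α d.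
  third : Dart n → Dart n
  third d = α (σ d)

  record _⟶[_]_ (x : Dart n) (k : ℕ) (y : Dart n) : Set where
    field
      pentagon : Pentagon (α x)
      reach    : iter φ k (α x) ≡ y
  open _⟶[_]_

  ⟶-reverse : ∀ {x y k l} → k + l ≡ 5 → x ⟶[ k ] y → α y ⟶[ l ] α x
  ⟶-reverse {x} {y} {k} {l} k+l≡5 h = record
    { pentagon = subst Pentagon (sym (α-invol y)) (Pentagon-SameFace (pentagon h) (k , reach h))
    ; reach    = begin
        iter φ l (α (α y))          ≡⟨ cong (iter φ l) (α-invol y) ⟩
        iter φ l y                  ≡⟨ cong (iter φ l) (sym (reach h)) ⟩
        iter φ l (iter φ k (α x))   ≡⟨ sym (iter-+ φ l k (α x)) ⟩
        iter φ (l + k) (α x)        ≡⟨ cong (λ m → iter φ m (α x)) (trans (+-comm l k) k+l≡5) ⟩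
        iter φ 5 (α x)              ≡⟨ pentagon h ⟩
        α x                         ∎
    }

  third-short : ∀ {x y} → x ⟶[ 2 ] y → φ (third y) ≡ third x
  third-short {x} {y} h = begin
    φ (third y)           ≡⟨ φ-α (σ y) ⟩
    σ (σ y)               ≡⟨ cong (σ ∘ σ) (sym (reach h)) ⟩
    σ (σ (φ (φ (α x))))   ≡⟨ cong (σ ∘ σ ∘ φ) (φ-α x) ⟩
    σ (σ (σ (third x)))   ≡⟨ σ³ (third x) ⟩
    third x               ∎

  third-long : ∀ {x y} → x ⟶[ 3 ] y → φ (φ (third y)) ≡ σ (σ (third x))
  third-long {x} {y} h = begin
    φ (φ (third y))                 ≡⟨ cong φ (φ-α (σ y)) ⟩
    φ (σ (σ y))                     ≡⟨ cong (φ ∘ σ ∘ σ) (sym (reach h)) ⟩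
    φ (σ (σ (φ (φ (φ (α x))))))     ≡⟨ cong (φ ∘ σ ∘ σ ∘ φ ∘ φ) (φ-α x) ⟩
    φ (σ (σ (σ (α (σ (third x)))))) ≡⟨ cong φ (σ³ _) ⟩
    φ (α (σ (third x)))             ≡⟨ φ-α (σ (third x)) ⟩
    σ (σ (third x))                 ∎

  data Hop (x y : Dart n) : Set where
    short : x ⟶[ 2 ] y → Hop x y
    long  : x ⟶[ 3 ] y → Hop x y

  Cycle : ℕ → (x₀ x₁ x₂ x₃ x₄ : Dart n) → Set
  Cycle k x₀ x₁ x₂ x₃ x₄ =
    x₀ ⟶[ k ] x₁ × x₁ ⟶[ k ] x₂ × x₂ ⟶[ k ] x₃ × x₃ ⟶[ k ] x₄ × x₄ ⟶[ k ] x₀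

  Cycle-reverse : ∀ {x₀ x₁ x₂ x₃ x₄} → Cycle 3 x₀ x₁ x₂ x₃ x₄ →
                  Cycle 2 (α x₀) (α x₄) (α x₃) (α x₂) (α x₁)
  Cycle-reverse (h₀ , h₁ , h₂ , h₃ , h₄) =
    ⟶-reverse refl h₄ , ⟶-reverse refl h₃ , ⟶-reverse refl h₂ , ⟶-reverse refl h₁ , ⟶-reverse refl h₀

  short-cycle-centre : ∀ {x₀ x₁ x₂ x₃ x₄} → Cycle 2 x₀ x₁ x₂ x₃ x₄ →
    Pentagon (third x₀) × SameFace M (third x₀) (third x₁) × SameFace M (third x₀) (third x₂)
                        × SameFace M (third x₀) (third x₃) × SameFace M (third x₀) (third x₄)
  short-cycle-centre {x₀} {x₁} {x₂} {x₃} {x₄} (h₀ , h₁ , h₂ , h₃ , h₄) =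
    to₀ , (4 , to₁) , (3 , to₂) , (2 , to₃) , (1 , to₄)
    where
    to₄ : iter φ 1 (third x₀) ≡ third x₄
    to₄ = third-short h₄
    to₃ : iter φ 2 (third x₀) ≡ third x₃
    to₃ = trans (cong φ to₄) (third-short h₃)
    to₂ : iter φ 3 (third x₀) ≡ third x₂
    to₂ = trans (cong φ to₃) (third-short h₂)
    to₁ : iter φ 4 (third x₀) ≡ third x₁
    to₁ = trans (cong φ to₂) (third-short h₁)
    to₀ : iter φ 5 (third x₀) ≡ third x₀
    to₀ = trans (cong φ to₁) (third-short h₀)

  EdgeBetween : Dart n → Dart n → Set
  EdgeBetween c g = Σ (Dart n) λ y → SameFace M c (α y) × SameFace M g y

  Adjacent : Dart n → Dart n → Set
  Adjacent c g = ¬ SameFace M c g × Σ (Dart n) λ e → EdgeOnFace M e c × EdgeOnFace M e g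

  module _ (simple : Simple M) where
    open Simple simple using (noLoop)

    α-no-fixpoint : ∀ d → α d ≢ d
    α-no-fixpoint d p = noLoop d (cong vert p)

    φ≢σ² : ∀ d → φ d ≢ σ (σ d)
    φ≢σ² d p = noLoop d (cong vert (σ-injective p))

    φ²≢α : ∀ d → φ (φ d) ≢ α d
    φ²≢α d p = noLoop (φ d) (cong vert p)

    φσ²-no-fixpoint : ∀ d → φ (σ (σ d)) ≢ d
    φσ²-no-fixpoint d p = α-no-fixpoint (σ (σ d)) (σ-injective (trans p (sym (σ³ d))))

    SameEdge-φ : ∀ {e d} → SameEdge M e d → ¬ SameEdge M e (φ d)
    SameEdge-φ {e} (inj₁ refl) (inj₁ p) = noLoop e (cong vert p)
    SameEdge-φ {e} (inj₁ refl) (inj₂ p) = σ-no-fixpoint (α e) p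
    SameEdge-φ {e} (inj₂ refl) (inj₁ p) = σ-no-fixpoint (α (α e)) (trans p (sym (α-invol e)))
    SameEdge-φ {e} (inj₂ refl) (inj₂ p) = noLoop (α e) (cong vert p)

    SameEdge⇒Endpoint : ∀ {e x} → SameEdge M e x → Endpoint M (vert x) e
    SameEdge⇒Endpoint (inj₁ refl) = inj₁ refl
    SameEdge⇒Endpoint (inj₂ refl) = inj₂ refl

    SameEdge⇒Endpoint-α : ∀ {e x} → SameEdge M e x → Endpoint M (vert (α x)) e
    SameEdge⇒Endpoint-α     (inj₁ refl) = inj₂ refl
    SameEdge⇒Endpoint-α {e} (inj₂ refl) = inj₁ (cong vert (α-invol e))

    pentagon-edge-once : ∀ {d} → Pentagon d → ¬ SameFace M d (α d)
    pentagon-edge-once {d} p s with pentagon-position p s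
    ... | 0F , r = α-no-fixpoint d (sym r)
    ... | 1F , r = σ-no-fixpoint (α d) r
    ... | 2F , r = φ²≢α d r
    ... | 3F , r = φ²≢α (α d) (trans (cong (φ ∘ φ) (sym r)) (trans p (sym (α-invol d))))
    ... | 4F , r = σ-no-fixpoint d (trans (sym (φ-α d)) (trans (cong φ (sym r)) p))

    pentagon-adjacent : ∀ {c g} → Pentagon c → EdgeBetween c g → Adjacent c g
    pentagon-adjacent {c} {g} pc (y , c∋αy , g∋y) = distinct , y , inj₂ c∋αy , inj₁ g∋y
      where
      distinct : ¬ SameFace M c g
      distinct c∼g = pentagon-edge-once (Pentagon-SameFace pc c∋y)
                       (SameFace-trans (SameFace-sym pc c∋y) c∋αy)
        where
        c∋y : SameFace M c y
        c∋y = SameFace-trans c∼g g∋y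

    module _ (faces : ∀ d → FaceSize M d 5 ⊎ FaceSize M d 6) where

      pentagon-or-hexagon : ∀ d → Pentagon d ⊎ iter φ 6 d ≡ d
      pentagon-or-hexagon d = Sum.map (proj₁ ∘ proj₂) (proj₁ ∘ proj₂) (faces d)

      Pentagon⇒FaceSize : ∀ {d} → Pentagon d → FaceSize M d 5
      Pentagon⇒FaceSize {d} p with faces d
      ... | inj₁ five           = five
      ... | inj₂ (_ , _ , min)  = ⊥-elim (min 5 z<s (n<1+n 5) p)

      no-short-period : ∀ d k → 0 < k → k < 5 → iter φ k d ≢ d
      no-short-period d k 0<k k<5 with faces d
      ... | inj₁ (_ , _ , min) = min k 0<k k<5
      ... | inj₂ (_ , _ , min) = min k 0<k (m<n⇒m<1+n k<5)

      ¬cycle-32222 : ∀ {x₀ x₁ x₂ x₃ x₄} → x₀ ⟶[ 3 ] x₁ → x₁ ⟶[ 2 ] x₂ →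
                     x₂ ⟶[ 2 ] x₃ → x₃ ⟶[ 2 ] x₄ → x₄ ⟶[ 2 ] x₀ → ⊥
      ¬cycle-32222 {x₀} {x₁} {x₂} {x₃} {x₄} h₀ h₁ h₂ h₃ h₄ =
        [ pentagonal , hexagonal ]′ (pentagon-or-hexagon t₀)
        where
        t₀ t₁ : Dart n
        t₀ = third x₀
        t₁ = third x₁
        φ⁴t₀≡t₁ : iter φ 4 t₀ ≡ t₁
        φ⁴t₀≡t₁ = begin
          φ (φ (φ (φ t₀)))     ≡⟨ cong (φ ∘ φ ∘ φ) (third-short h₄) ⟩
          φ (φ (φ (third x₄))) ≡⟨ cong (φ ∘ φ) (third-short h₃) ⟩
          φ (φ (third x₃))     ≡⟨ cong φ (third-short h₂) ⟩
          φ (third x₂)         ≡⟨ third-short h₁ ⟩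
          t₁                   ∎
        pentagonal : Pentagon t₀ → ⊥
        pentagonal five = φ≢σ² t₀ (begin
          φ t₀            ≡⟨ cong φ (sym five) ⟩
          φ (iter φ 5 t₀) ≡⟨ cong (φ ∘ φ) φ⁴t₀≡t₁ ⟩
          φ (φ t₁)        ≡⟨ third-long h₀ ⟩
          σ (σ t₀)        ∎)
        hexagonal : iter φ 6 t₀ ≡ t₀ → ⊥
        hexagonal six = σ²-no-fixpoint t₀ (begin
          σ (σ t₀)    ≡⟨ sym (third-long h₀) ⟩
          φ (φ t₁)    ≡⟨ cong (φ ∘ φ) (sym φ⁴t₀≡t₁) ⟩
          iter φ 6 t₀ ≡⟨ six ⟩
          t₀          ∎)

      ¬cycle-33222 : ∀ {x₀ x₁ x₂ x₃ x₄} → x₀ ⟶[ 3 ] x₁ → x₁ ⟶[ 3 ] x₂ →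
                     x₂ ⟶[ 2 ] x₃ → x₃ ⟶[ 2 ] x₄ → x₄ ⟶[ 2 ] x₀ → ⊥
      ¬cycle-33222 {x₀} {x₁} {x₂} {x₃} {x₄} h₀ h₁ h₂ h₃ h₄ =
        [ pentagonal , hexagonal ]′ (pentagon-or-hexagon t₀)
        where
        t₀ t₁ : Dart n
        t₀ = third x₀
        t₁ = third x₁
        φ⁵t₀≡σ²t₁ : iter φ 5 t₀ ≡ σ (σ t₁)
        φ⁵t₀≡σ²t₁ = begin
          φ (φ (φ (φ (φ t₀))))     ≡⟨ cong (φ ∘ φ ∘ φ ∘ φ) (third-short h₄) ⟩
          φ (φ (φ (φ (third x₄)))) ≡⟨ cong (φ ∘ φ ∘ φ) (third-short h₃) ⟩
          φ (φ (φ (third x₃)))     ≡⟨ cong (φ ∘ φ) (third-short h₂) ⟩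
          φ (φ (third x₂))         ≡⟨ third-long h₁ ⟩
          σ (σ t₁)                 ∎
        pentagonal : Pentagon t₀ → ⊥
        pentagonal five = φ²≢σ t₁ (begin
          φ (φ t₁)                 ≡⟨ third-long h₀ ⟩
          σ (σ t₀)                 ≡⟨ cong (σ ∘ σ) (trans (sym five) φ⁵t₀≡σ²t₁) ⟩
          σ (σ (σ (σ t₁)))         ≡⟨ cong σ (σ³ t₁) ⟩
          σ t₁                     ∎)
        -- The face of t₁ would be a triangle.
        hexagonal : iter φ 6 t₀ ≡ t₀ → ⊥
        hexagonal six = no-short-period t₁ 3 z<s (m<n⇒m<1+n (n<1+n 3)) (begin
          σ (α (φ (φ t₁)))         ≡⟨ cong (σ ∘ α) (third-long h₀) ⟩
          σ (α (σ (σ t₀)))         ≡⟨ cong σ pred-t₀ ⟩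
          σ (σ (σ t₁))             ≡⟨ σ³ t₁ ⟩
          t₁                       ∎)
          where
          pred-t₀ : α (σ (σ t₀)) ≡ σ (σ t₁)
          pred-t₀ = φ-injective (begin
            φ (α (σ (σ t₀)))       ≡⟨ φ-α-σ² t₀ ⟩
            t₀                     ≡⟨ sym six ⟩
            φ (iter φ 5 t₀)        ≡⟨ cong φ φ⁵t₀≡σ²t₁ ⟩
            φ (σ (σ t₁))           ∎)

      ¬cycle-32322 : ∀ {x₀ x₁ x₂ x₃ x₄} → x₀ ⟶[ 3 ] x₁ → x₁ ⟶[ 2 ] x₂ →
                     x₂ ⟶[ 3 ] x₃ → x₃ ⟶[ 2 ] x₄ → x₄ ⟶[ 2 ] x₀ → ⊥
      ¬cycle-32322 {x₀} {x₁} {x₂} {x₃} {x₄} h₀ h₁ h₂ h₃ h₄ =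
        [ pentagonal , hexagonal ]′ (pentagon-or-hexagon t₀)
        where
        t₀ t₂ u : Dart n
        t₀ = third x₀
        t₂ = third x₂
        u  = α (σ (σ t₂))
        φ⁴t₀≡σ²t₂ : iter φ 4 t₀ ≡ σ (σ t₂)
        φ⁴t₀≡σ²t₂ = begin
          φ (φ (φ (φ t₀)))         ≡⟨ cong (φ ∘ φ ∘ φ) (third-short h₄) ⟩
          φ (φ (φ (third x₄)))     ≡⟨ cong (φ ∘ φ) (third-short h₃) ⟩
          φ (φ (third x₃))         ≡⟨ third-long h₂ ⟩
          σ (σ t₂)                 ∎
        φ⁴u≡σ²t₀ : iter φ 4 u ≡ σ (σ t₀)
        φ⁴u≡σ²t₀ = begin
          φ (φ (φ (φ u)))          ≡⟨ cong (φ ∘ φ ∘ φ) (φ-α-σ² t₂) ⟩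
          φ (φ (φ t₂))             ≡⟨ cong (φ ∘ φ) (third-short h₁) ⟩
          φ (φ (third x₁))         ≡⟨ third-long h₀ ⟩
          σ (σ t₀)                 ∎
        -- The face of u would be a quadrangle.
        pentagonal : Pentagon t₀ → ⊥
        pentagonal five = no-short-period u 4 z<s (n<1+n 4) (begin
          iter φ 4 u               ≡⟨ φ⁴u≡σ²t₀ ⟩
          σ (σ t₀)                 ≡⟨ sym (α-invol _) ⟩
          α (α (σ (σ t₀)))         ≡⟨ cong α pred-t₀ ⟩
          u                        ∎)
          where
          pred-t₀ : α (σ (σ t₀)) ≡ σ (σ t₂)
          pred-t₀ = φ-injective (begin
            φ (α (σ (σ t₀)))       ≡⟨ φ-α-σ² t₀ ⟩
            t₀                     ≡⟨ sym five ⟩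
            φ (iter φ 4 t₀)        ≡⟨ cong φ φ⁴t₀≡σ²t₂ ⟩
            φ (σ (σ t₂))           ∎)
        hexagonal : iter φ 6 t₀ ≡ t₀ → ⊥
        hexagonal six = [ σ²-no-fixpoint u ∘ trans (sym φ⁵u≡σ²u)
                        , φσ²-no-fixpoint u ∘ trans (cong φ (sym φ⁵u≡σ²u)) ]′
                        (pentagon-or-hexagon u)
          where
          σu≡pred-t₀ : σ u ≡ α (σ (σ t₀))
          σu≡pred-t₀ = φ-injective (begin
            φ (σ u)                ≡⟨⟩
            φ (φ (σ (σ t₂)))       ≡⟨ cong (φ ∘ φ) (sym φ⁴t₀≡σ²t₂) ⟩
            iter φ 6 t₀            ≡⟨ six ⟩
            t₀                     ≡⟨ sym (φ-α-σ² t₀) ⟩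
            φ (α (σ (σ t₀)))       ∎)
          φ⁵u≡σ²u : iter φ 5 u ≡ σ (σ u)
          φ⁵u≡σ²u = begin
            φ (iter φ 4 u)         ≡⟨ cong φ φ⁴u≡σ²t₀ ⟩
            φ (σ (σ t₀))           ≡⟨ cong φ (sym (α-invol _)) ⟩
            φ (α (α (σ (σ t₀))))   ≡⟨ cong (φ ∘ α) (sym σu≡pred-t₀) ⟩
            φ (α (σ u))            ≡⟨ φ-α (σ u) ⟩
            σ (σ u)                ∎

      ¬long-short : ∀ {x₀ x₁ x₂ x₃ x₄} → x₀ ⟶[ 3 ] x₁ → x₁ ⟶[ 2 ] x₂ →
                    Hop x₂ x₃ → Hop x₃ x₄ → Hop x₄ x₀ → ⊥
      ¬long-short h₀ h₁ (short h₂) (short h₃) (short h₄) = ¬cycle-32222 h₀ h₁ h₂ h₃ h₄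
      ¬long-short h₀ h₁ (short h₂) (short h₃) (long h₄)  = ¬cycle-33222 h₄ h₀ h₁ h₂ h₃
      ¬long-short h₀ h₁ (short h₂) (long h₃)  (short h₄) = ¬cycle-32322 h₃ h₄ h₀ h₁ h₂
      ¬long-short h₀ h₁ (long h₂)  (short h₃) (short h₄) = ¬cycle-32322 h₀ h₁ h₂ h₃ h₄
      ¬long-short h₀ h₁ (short h₂) (long h₃)  (long h₄)  =
        ¬cycle-33222 (⟶-reverse refl h₂) (⟶-reverse refl h₁) (⟶-reverse refl h₀)
                     (⟶-reverse refl h₄) (⟶-reverse refl h₃)
      ¬long-short h₀ h₁ (long h₂)  (short h₃) (long h₄)  =
        ¬cycle-32322 (⟶-reverse refl h₃) (⟶-reverse refl h₂) (⟶-reverse refl h₁)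
                     (⟶-reverse refl h₀) (⟶-reverse refl h₄)
      ¬long-short h₀ h₁ (long h₂)  (long h₃)  (short h₄) =
        ¬cycle-32322 (⟶-reverse refl h₁) (⟶-reverse refl h₀) (⟶-reverse refl h₄)
                     (⟶-reverse refl h₃) (⟶-reverse refl h₂)
      ¬long-short h₀ h₁ (long h₂)  (long h₃)  (long h₄)  =
        ¬cycle-32222 (⟶-reverse refl h₁) (⟶-reverse refl h₀) (⟶-reverse refl h₄)
                     (⟶-reverse refl h₃) (⟶-reverse refl h₂)

      Cycle-uniform : ∀ {x₀ x₁ x₂ x₃ x₄} → Hop x₀ x₁ → Hop x₁ x₂ → Hop x₂ x₃ → Hop x₃ x₄ → Hop x₄ x₀ →
                      Cycle 2 x₀ x₁ x₂ x₃ x₄ ⊎ Cycle 3 x₀ x₁ x₂ x₃ x₄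
      Cycle-uniform (short h₀) (short h₁) (short h₂) (short h₃) (short h₄) = inj₁ (h₀ , h₁ , h₂ , h₃ , h₄)
      Cycle-uniform (long h₀)  (long h₁)  (long h₂)  (long h₃)  (long h₄)  = inj₂ (h₀ , h₁ , h₂ , h₃ , h₄)
      Cycle-uniform (long h₀) (short h₁) h₂ h₃ h₄ = ⊥-elim (¬long-short h₀ h₁ h₂ h₃ h₄)
      Cycle-uniform h₀ (long h₁) (short h₂) h₃ h₄ = ⊥-elim (¬long-short h₁ h₂ h₃ h₄ h₀)
      Cycle-uniform h₀ h₁ (long h₂) (short h₃) h₄ = ⊥-elim (¬long-short h₂ h₃ h₄ h₀ h₁)
      Cycle-uniform h₀ h₁ h₂ (long h₃) (short h₄) = ⊥-elim (¬long-short h₃ h₄ h₀ h₁ h₂)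
      Cycle-uniform (short h₀) h₁ h₂ h₃ (long h₄) = ⊥-elim (¬long-short h₄ h₀ h₁ h₂ h₃)

      module _ (R : PentagonalRing M 5) where
        open PentagonalRing R
        open PolygonalRing ring

        ≢nextFin : ∀ (i : Fin 5) → i ≢ nextFin i
        ≢nextFin 0F ()
        ≢nextFin 1F ()
        ≢nextFin 2F ()
        ≢nextFin 3F ()
        ≢nextFin 4F ()

        ends-apart : ∀ i {u w} → Endpoint M u (e i) → Endpoint M w (e (nextFin i)) → u ≢ w
        ends-apart i p q refl = matching i (nextFin i) (≢nextFin i) _ p q

        no-common-dart : ∀ i {d} → SameFace M (f i) d → ¬ SameFace M (f (nextFin i)) d
        no-common-dart i p q = SameEdge-φ (onlyEdge i _ (inj₁ p) (inj₁ q))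
                                          (onlyEdge i _ (inj₁ (SameFace-φ p)) (inj₁ (SameFace-φ q)))

        oriented-edge : ∀ i → Σ (Dart n) λ x →
          SameEdge M (e i) x × SameFace M (f i) x × SameFace M (f (nextFin i)) (α x)
        oriented-edge i with e-on-f i | e-on-f⁺ i
        ... | inj₁ p | inj₂ q = e i , inj₁ refl , p , q
        ... | inj₂ p | inj₁ q = α (e i) , inj₂ refl , p , subst (SameFace M (f (nextFin i))) (sym (α-invol (e i))) q
        ... | inj₁ p | inj₁ q = ⊥-elim (no-common-dart i p q)
        ... | inj₂ p | inj₂ q = ⊥-elim (no-common-dart i p q)

        a : Fin 5 → Dart n
        a i = proj₁ (oriented-edge i)

        a-edge : ∀ i → SameEdge M (e i) (a i)
        a-edge i = proj₁ (proj₂ (oriented-edge i))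

        f∋a : ∀ i → SameFace M (f i) (a i)
        f∋a i = proj₁ (proj₂ (proj₂ (oriented-edge i)))

        f⁺∋αa : ∀ i → SameFace M (f (nextFin i)) (α (a i))
        f⁺∋αa i = proj₂ (proj₂ (proj₂ (oriented-edge i)))

        Pentagon-f : ∀ i → Pentagon (f i)
        Pentagon-f i = proj₁ (proj₂ (pent i))

        Pentagon-αa : ∀ i → Pentagon (α (a i))
        Pentagon-αa i = Pentagon-SameFace (Pentagon-f (nextFin i)) (f⁺∋αa i)

        -- Positions 0, 1 and 4 would give eᵢ and eᵢ₊₁ a common endpoint.
        hop : ∀ i → Hop (a i) (a (nextFin i))
        hop i with pentagon-position (Pentagon-αa i)
                     (SameFace-trans (SameFace-sym (Pentagon-f (nextFin i)) (f⁺∋αa i)) (f∋a (nextFin i)))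
        ... | 0F , r = ⊥-elim (ends-apart i (SameEdge⇒Endpoint-α (a-edge i))
                                 (SameEdge⇒Endpoint (a-edge (nextFin i))) (cong vert r))
        ... | 1F , r = ⊥-elim (ends-apart i (SameEdge⇒Endpoint (a-edge i))
                                 (SameEdge⇒Endpoint (a-edge (nextFin i)))
                                 (trans (cong vert (sym (α-invol (a i)))) (cong vert r)))
        ... | 2F , r = short (record { pentagon = Pentagon-αa i ; reach = r })
        ... | 3F , r = long (record { pentagon = Pentagon-αa i ; reach = r })
        ... | 4F , r = ⊥-elim (ends-apart i (SameEdge⇒Endpoint-α (a-edge i))
                                 (SameEdge⇒Endpoint-α (a-edge (nextFin i)))
                                 (cong vert (sym (trans (cong φ (sym r)) (Pentagon-αa i)))))

        record Centre : Set where
          field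
            centre     : Dart n
            pentagonal : Pentagon centre
            meets      : ∀ i → EdgeBetween centre (f i)

        inner-centre : Cycle 2 (a 0F) (a 1F) (a 2F) (a 3F) (a 4F) → Centre
        inner-centre shorts with short-cycle-centre shorts
        ... | p , c∋₁ , c∋₂ , c∋₃ , c∋₄ = record
          { centre     = third (a 0F)
          ; pentagonal = p
          ; meets      = λ where
              0F → σ (a 4F) , c∋₄        , SameFace-across (f⁺∋αa 4F)
              1F → σ (a 0F) , (0 , refl) , SameFace-across (f⁺∋αa 0F)
              2F → σ (a 1F) , c∋₁        , SameFace-across (f⁺∋αa 1F)
              3F → σ (a 2F) , c∋₂        , SameFace-across (f⁺∋αa 2F)
              4F → σ (a 3F) , c∋₃        , SameFace-across (f⁺∋αa 3F)
          }

        outer-centre : Cycle 3 (a 0F) (a 1F) (a 2F) (a 3F) (a 4F) → Centre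
        outer-centre longs with short-cycle-centre (Cycle-reverse longs)
        ... | p , c∋₄ , c∋₃ , c∋₂ , c∋₁ = record
          { centre     = third (α (a 0F))
          ; pentagonal = p
          ; meets      = λ where
              0F → φ (a 0F) , (0 , refl) , SameFace-φ (f∋a 0F)
              1F → φ (a 1F) , c∋₁        , SameFace-φ (f∋a 1F)
              2F → φ (a 2F) , c∋₂        , SameFace-φ (f∋a 2F)
              3F → φ (a 3F) , c∋₃        , SameFace-φ (f∋a 3F)
              4F → φ (a 4F) , c∋₄        , SameFace-φ (f∋a 4F)
          }

        ring-centre : Centre
        ring-centre = [ inner-centre , outer-centre ]′
                        (Cycle-uniform (hop 0F) (hop 1F) (hop 2F) (hop 3F) (hop 4F))

        Centre⇒surrounded : Centre → Σ (Dart n) λ c → FaceSize M c 5 × (∀ i → Adjacent c (f i))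
        Centre⇒surrounded C = centre , Pentagon⇒FaceSize pentagonal , λ i → pentagon-adjacent pentagonal (meets i)
          where open Centre C

corollary4p7 : ∀ {n} (M : CubicMap n) → IsFullerene M → (R : PentagonalRing M 5) →
    Σ (Dart n) λ c → FaceSize M c 5 ×
      (∀ i → ¬ SameFace M c (PolygonalRing.f (PentagonalRing.ring R) i)
             × Σ (Dart n) λ e → EdgeOnFace M e c
                              × EdgeOnFace M e (PolygonalRing.f (PentagonalRing.ring R) i))
corollary4p7 M F R = Centre⇒surrounded M simple faces56 R (ring-centre M simple faces56 R)
  where open IsFullerene F
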